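{- Let $n$ be a positive integer. Let $L_n$ be the graph with vertex set $\{r,v_n,v_{n-1},\dots,v_1\}\cup\{u_0,u_1,\dots,u_{2^{n+1}}\}$ whose edges are those of the path $r\,v_n\,v_{n-1}\cdots v_1$ (a path of length $n$) together with the edges $v_1u_i$ and $u_iu_0$ for every $i\in\{1,\dots,2^{n+1}\}$ (so $v_1$ and $u_0$ are joined by $2^{n+1}$ internally disjoint paths of length $2$). Root $L_n$ at $r$. Let $w$ be the weight function with $w(r)=0$, $w(v_j)=2^j$ for $j\in\{1,\dots,n\}$, and $w(u_i)=1$ for $i\in\{0,1,\dots,2^{n+1}\}$. Then $w$ is a valid weight function on $L_n$ rooted at $r$.
   Context: A configuration on a graph $G$ is a function $p:V(G)\to\mathbb{N}\cup\{0\}$ ($p(v)$ is the number of pebbles on $v$). A pebbling move from a vertex $u$ to an adjacent vertex $v$ removes two pebbles from $u$ and places one pebble on $v$. For a root $r$, a configuration $p$ is $r$-solvable if some (possibly empty) sequence of pebbling moves starting from $p$ places at least one pebble on $r$; otherwise it is $r$-unsolvable. A weight function is a function $w:V(G)\to\mathbb{R}_{\ge 0}$, and the weight of a configuration is $w(p)=\sum_{v\in V(G)}p(v)w(v)$. $1_G$ denotes the configuration with exactly one pebble on every vertex of $G$, so $w(1_G)=\sum_{v\in V(G)}w(v)$. A weight function $w$ on $G$ rooted at $r$ is valid if $r$ is the only vertex with weight $0$ and every $r$-unsolvable configuration $p$ satisfies $w(p)\le w(1_G)$. -}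

module Defs where

open import Data.Nat using (ℕ; zero; suc; _+_; _*_; _^_; _≤_; _∸_)
open import Data.Fin using (Fin; toℕ; zero; suc)
open import Data.List using (List; []; _∷_; _++_; map; allFin)
open import Data.Nat.ListAction using (sum)
open import Data.Product using (Σ; _×_; ∃-syntax)
open import Data.Sum using (_⊎_)
open import Relation.Nullary using (¬_)
open import Relation.Binary.PropositionalEquality using (_≡_; _≢_)
open import Relation.Binary.Construct.Closure.ReflexiveTransitive using (Star)

-- A graph is given by a vertex type V, an (undirected) adjacency relation
-- Adj, and a list `verts` enumerating every vertex exactly once (used
-- to form the finite sum defining the weight of a configuration).

module Pebbling (V : Set) (Adj : V → V → Set) (verts : List V) where

  Config : Set
  Config = V → ℕ

  Move : Config → Config → Set
  Move p q = Σ V λ x → Σ V λ y →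
               Adj x y
             × (q x + 2 ≡ p x)
             × (q y ≡ suc (p y))
             × (∀ z → z ≢ x → z ≢ y → q z ≡ p z)

  Reach : Config → Config → Set
  Reach = Star Move

  Solvable : V → Config → Set
  Solvable root p = ∃[ q ] (Reach p q × 1 ≤ q root)

  Unsolvable : V → Config → Set
  Unsolvable root p = ¬ Solvable root p

  weight : (V → ℕ) → Config → ℕ
  weight w p = sum (map (λ x → p x * w x) verts)

  one : Config
  one _ = 1

  Valid : V → (V → ℕ) → Set
  Valid root w =
      (w root ≡ 0)
    × (∀ x → w x ≡ 0 → x ≡ root)
    × (∀ p → Unsolvable root p → weight w p ≤ weight w one)

-- The graph L_n.
-- Vertices: r; v k for k : Fin n, standing for v_{k+1} (so v_1 .. v_n);
-- u i for i : Fin (2^(n+1) + 1), standing for u_i (i = 0 .. 2^(n+1)).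

NU : ℕ → ℕ
NU n = suc (2 ^ suc n)

data LV (n : ℕ) : Set where
  r : LV n
  v : Fin n → LV n
  u : Fin (NU n) → LV n

data LEdge (n : ℕ) : LV n → LV n → Set where
  e-rv  : (k : Fin n) → suc (toℕ k) ≡ n → LEdge n r (v k)
  e-vv  : (k k' : Fin n) → toℕ k' ≡ suc (toℕ k) → LEdge n (v k') (v k)
  e-v1u : (k : Fin n) → toℕ k ≡ 0 → (i : Fin (NU n)) → toℕ i ≢ 0 → LEdge n (v k) (u i)
  e-uu0 : (i : Fin (NU n)) → toℕ i ≢ 0 → LEdge n (u i) (u zero)

LAdj : (n : ℕ) → LV n → LV n → Set
LAdj n x y = LEdge n x y ⊎ LEdge n y x

Lverts : (n : ℕ) → List (LV n)
Lverts n = r ∷ (map v (allFin n) ++ map u (allFin (NU n)))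

Lw : (n : ℕ) → LV n → ℕ
Lw n r = 0
Lw n (v k) = 2 ^ suc (toℕ k)
Lw n (u i) = 1

module LPeb (n : ℕ) = Pebbling (LV n) (LAdj n) (Lverts n)

{-# OPTIONS --safe #-}
module Submission where

-- Write N = 2^(n+1), W for the weight of a configuration, O for the number of spokes u_1 … u_N
-- holding an odd number of pebbles and Z for the number of pebbles on the hub u_0, and call a
-- configuration ample when N + O ≤ W and 2N + Z ≤ 2W. A configuration heavier than 1_L has
-- W ≥ 2N and is ample. From an ample configuration either r is one move away, or some move keeps
-- it ample: a pair moves up the path or from a spoke to v_1 (W, O and Z are unchanged), or the
-- hub sends a pair to a spoke (W drops by 1 and Z by 2, while O drops by 1 if that spoke held
-- one pebble and rises from 0 to 1 if every spoke is empty). When the path and the spokes hold at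
-- most one pebble each, W + 2 ≤ N + O + Z; this refutes ampleness if also Z ≤ 1, and otherwise
-- gives the slack needed to fill an empty spoke. Every move loses a pebble, so r is reached.

open import Data.Empty using (⊥-elim)
open import Data.Fin as Fin using (Fin; zero; suc; toℕ; fromℕ<)
open import Data.Fin.Properties using (any?; toℕ<n; toℕ-fromℕ<)
open import Data.List using (List; _∷_; _++_; map; tabulate; allFin)
open import Data.List.Membership.Propositional using (_∈_)
open import Data.List.Membership.Propositional.Properties
  using (∈-map⁺; ∈-map⁻; ∈-++⁺ˡ; ∈-++⁺ʳ; ∈-allFin)
open import Data.List.Properties using (map-cong-local; map-++; map-tabulate; tabulate-cong)
open import Data.List.Relation.Unary.All as All using (All)
import Data.List.Relation.Unary.All.Properties as All
open import Data.List.Relation.Unary.AllPairs using (_∷_)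
open import Data.List.Relation.Unary.Any using (here; there)
open import Data.List.Relation.Unary.Unique.Propositional using (Unique)
import Data.List.Relation.Unary.Unique.Propositional.Properties as Unique
open import Data.Nat
open import Data.Nat.DivMod using (_%_; m%n<n; [m+n]%n≡m%n)
open import Data.Nat.ListAction using (sum)
open import Data.Nat.ListAction.Properties using (sum-++)
open import Data.Nat.Properties
open import Algebra.Properties.CommutativeSemigroup +-commutativeSemigroup
  using (xy∙z≈zy∙x; xy∙z≈xz∙y; x∙yz≈xz∙y)
open import Data.Nat.Tactic.RingSolver using (solve-∀)
open import Data.Product using (Σ; _×_; _,_)
open import Data.Sum using (_⊎_; inj₁; inj₂; [_,_])
open import Function using (_∘_; id)
open import Relation.Binary.Construct.Closure.ReflexiveTransitive using (ε; _◅_)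
open import Relation.Binary.Definitions using (DecidableEquality)
open import Relation.Binary.PropositionalEquality hiding ([_])
open import Relation.Nullary using (¬_; yes; no)
open import Relation.Nullary.Decidable using (map′)

open import Defs

sum-map-differ-at : ∀ {A : Set} {f g : A → ℕ} {x : A} (xs : List A) → Unique xs → x ∈ xs →
                    (∀ z → z ≢ x → f z ≡ g z) → sum (map f xs) + g x ≡ sum (map g xs) + f x
sum-map-differ-at {f = f} {g} (a ∷ xs) (a∉xs ∷ _) (here refl) f≡g = begin
  f a + sum (map f xs) + g a  ≡⟨ cong (λ s → f a + s + g a) (cong sum f≡g-on-xs) ⟩
  f a + sum (map g xs) + g a  ≡⟨ xy∙z≈zy∙x (f a) _ (g a) ⟩
  g a + sum (map g xs) + f a  ∎
  where
  open ≡-Reasoning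
  f≡g-on-xs : map f xs ≡ map g xs
  f≡g-on-xs = map-cong-local (All.map (λ a≢z → f≡g _ (a≢z ∘ sym)) a∉xs)
sum-map-differ-at {f = f} {g} {x} (a ∷ xs) (a∉xs ∷ xs-unique) (there x∈xs) f≡g = begin
  f a + sum (map f xs) + g x    ≡⟨ +-assoc (f a) _ _ ⟩
  f a + (sum (map f xs) + g x)  ≡⟨ cong₂ _+_ (f≡g a (All.lookup a∉xs x∈xs))
                                             (sum-map-differ-at xs xs-unique x∈xs f≡g) ⟩
  g a + (sum (map g xs) + f x)  ≡⟨ +-assoc (g a) _ _ ⟨
  g a + sum (map g xs) + f x    ∎
  where open ≡-Reasoning

sum-tabulate-mono : ∀ {k} {f g : Fin k → ℕ} → (∀ i → f i ≤ g i) → sum (tabulate f) ≤ sum (tabulate g)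
sum-tabulate-mono {zero}  f≤g = z≤n
sum-tabulate-mono {suc k} f≤g = +-mono-≤ (f≤g zero) (sum-tabulate-mono (f≤g ∘ suc))

sum-tabulate-const : ∀ k c → sum (tabulate {n = k} (λ _ → c)) ≡ k * c
sum-tabulate-const zero    c = refl
sum-tabulate-const (suc k) c = cong (c +_) (sum-tabulate-const k c)

sum-tabulate-*ˡ : ∀ {k} c (f : Fin k → ℕ) → sum (tabulate (λ i → c * f i)) ≡ c * sum (tabulate f)
sum-tabulate-*ˡ {zero}  c f = sym (*-zeroʳ c)
sum-tabulate-*ˡ {suc k} c f = begin
  c * f zero + sum (tabulate (λ i → c * f (suc i)))  ≡⟨ cong (c * f zero +_) (sum-tabulate-*ˡ c (f ∘ suc)) ⟩
  c * f zero + c * sum (tabulate (f ∘ suc))          ≡⟨ *-distribˡ-+ c (f zero) _ ⟨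
  c * sum (tabulate f)                               ∎
  where open ≡-Reasoning

sum-tabulate-2^ : ∀ k → sum (tabulate {n = k} (λ i → 2 ^ suc (toℕ i))) + 2 ≡ 2 ^ suc k
sum-tabulate-2^ zero    = refl
sum-tabulate-2^ (suc k) = begin
  2 + sum (tabulate {n = k} (λ i → 2 * 2 ^ suc (toℕ i))) + 2
    ≡⟨ cong (λ t → 2 + t + 2) (sum-tabulate-*ˡ {k} 2 (λ i → 2 ^ suc (toℕ i))) ⟩
  2 + 2 * s + 2
    ≡⟨ double-shift s ⟩
  2 * (s + 2)
    ≡⟨ cong (2 *_) (sum-tabulate-2^ k) ⟩
  2 ^ suc (suc k) ∎
  where
  open ≡-Reasoning
  s : ℕ
  s = sum (tabulate {n = k} (λ i → 2 ^ suc (toℕ i)))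
  double-shift : ∀ s → 2 + 2 * s + 2 ≡ 2 * (s + 2)
  double-shift = solve-∀

module PebblingMoves
  (V : Set) (Adj : V → V → Set) (verts : List V)
  (_≟_ : DecidableEquality V) (verts-unique : Unique verts) (∈-verts : ∀ x → x ∈ verts)
  (Adj-irrefl : ∀ {x} → ¬ Adj x x)
  where

  open Pebbling V Adj verts

  Adj⇒≢ : ∀ {x y} → Adj x y → x ≢ y
  Adj⇒≢ adj refl = Adj-irrefl adj

  update : Config → V → ℕ → Config
  update p x c z with z ≟ x
  ... | yes _ = c
  ... | no  _ = p z

  update-≡ : ∀ p x c → update p x c x ≡ c
  update-≡ p x c with x ≟ x
  ... | yes _  = refl
  ... | no x≢x = ⊥-elim (x≢x refl)

  update-≢ : ∀ p {x} c {z} → z ≢ x → update p x c z ≡ p z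
  update-≢ p {x} c {z} z≢x with z ≟ x
  ... | yes z≡x = ⊥-elim (z≢x z≡x)
  ... | no  _   = refl

  move : Config → V → V → Config
  move p x y = update (update p x (p x ∸ 2)) y (suc (p y))

  module _ {p : Config} {x y : V} where

    move-target : move p x y y ≡ suc (p y)
    move-target = update-≡ _ y _

    move-source : x ≢ y → move p x y x ≡ p x ∸ 2
    move-source x≢y = trans (update-≢ _ _ x≢y) (update-≡ p x _)

    move-elsewhere : ∀ {z} → z ≢ x → z ≢ y → move p x y z ≡ p z
    move-elsewhere z≢x z≢y = trans (update-≢ _ _ z≢y) (update-≢ p _ z≢x)

    move-Move : Adj x y → 2 ≤ p x → Move p (move p x y)
    move-Move adj 2≤px =
      x , y , adj , trans (cong (_+ 2) (move-source (Adj⇒≢ adj))) (m∸n+n≡m 2≤px) ,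
      move-target , λ z z≢x z≢y → move-elsewhere z≢x z≢y

  vertexSum : (V → ℕ → ℕ) → Config → ℕ
  vertexSum F p = sum (map (λ x → F x (p x)) verts)

  vertexSum-update : ∀ F p x c → vertexSum F (update p x c) + F x (p x) ≡ vertexSum F p + F x c
  vertexSum-update F p x c =
    trans (sum-map-differ-at verts verts-unique (∈-verts x) (λ z z≢x → cong (F z) (update-≢ p c z≢x)))
          (cong (λ c′ → vertexSum F p + F x c′) (update-≡ p x c))

  vertexSum-move : ∀ F p {x y} → x ≢ y →
                   vertexSum F (move p x y) + F x (p x) + F y (p y)
                 ≡ vertexSum F p + F x (p x ∸ 2) + F y (suc (p y))
  vertexSum-move F p {x} {y} x≢y = begin
    S (move p x y) + F x (p x) + F y (p y)   ≡⟨ xy∙z≈xz∙y (S (move p x y)) _ _ ⟩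
    S (move p x y) + F y (p y) + F x (p x)   ≡⟨ cong (λ c → S (move p x y) + F y c + F x (p x))
                                                     (update-≢ p _ (x≢y ∘ sym)) ⟨
    S (move p x y) + F y (p₁ y) + F x (p x)  ≡⟨ cong (_+ F x (p x)) (vertexSum-update F p₁ y (suc (p y))) ⟩
    S p₁ + F y (suc (p y)) + F x (p x)       ≡⟨ xy∙z≈xz∙y (S p₁) _ _ ⟩
    S p₁ + F x (p x) + F y (suc (p y))       ≡⟨ cong (_+ F y (suc (p y))) (vertexSum-update F p x (p x ∸ 2)) ⟩
    S p + F x (p x ∸ 2) + F y (suc (p y))    ∎
    where
    open ≡-Reasoning
    S : Config → ℕ
    S = vertexSum F
    p₁ : Config
    p₁ = update p x (p x ∸ 2)

  module _ (w : V → ℕ) (p : Config) {x y : V} (adj : Adj x y) (2≤px : 2 ≤ p x) where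

    private
      W′ : ℕ
      W′ = weight w (move p x y)

      weight-exchange : W′ + p x * w x + p y * w y
                      ≡ weight w p + (p x ∸ 2) * w x + suc (p y) * w y
      weight-exchange = vertexSum-move (λ z c → c * w z) p (Adj⇒≢ adj)

    weight-move-doubling : w y ≡ 2 * w x → weight w (move p x y) ≡ weight w p
    weight-move-doubling wy≡2wx = +-cancelʳ-≡ (p x * w x + p y * w y) _ _ (begin
      W′ + (p x * w x + p y * w y)                      ≡⟨ +-assoc W′ _ _ ⟨
      W′ + p x * w x + p y * w y                        ≡⟨ weight-exchange ⟩
      weight w p + (p x ∸ 2) * w x + suc (p y) * w y    ≡⟨ +-assoc (weight w p) _ _ ⟩
      weight w p + ((p x ∸ 2) * w x + suc (p y) * w y)  ≡⟨ cong (weight w p +_) (exchange 2≤px (p y) wy≡2wx) ⟩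
      weight w p + (p x * w x + p y * w y)              ∎)
      where
      open ≡-Reasoning
      exchange : ∀ {a} → 2 ≤ a → ∀ b {c d} → d ≡ 2 * c → (a ∸ 2) * c + suc b * d ≡ a * c + b * d
      exchange {suc (suc a)} (s≤s (s≤s _)) b {c} refl = shuffle a b c
        where
        shuffle : ∀ a b c → a * c + suc b * (2 * c) ≡ suc (suc a) * c + b * (2 * c)
        shuffle = solve-∀

    weight-move-level : w y ≡ w x → weight w (move p x y) + w x ≡ weight w p
    weight-move-level wy≡wx = +-cancelʳ-≡ ((p x ∸ 2) * w x + suc (p y) * w y) _ _ (begin
      W′ + w x + ((p x ∸ 2) * w x + suc (p y) * w y)    ≡⟨ +-assoc W′ _ _ ⟩
      W′ + (w x + ((p x ∸ 2) * w x + suc (p y) * w y))  ≡⟨ cong (W′ +_) (exchange 2≤px (p y) wy≡wx) ⟩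
      W′ + (p x * w x + p y * w y)                      ≡⟨ +-assoc W′ _ _ ⟨
      W′ + p x * w x + p y * w y                        ≡⟨ weight-exchange ⟩
      weight w p + (p x ∸ 2) * w x + suc (p y) * w y    ≡⟨ +-assoc (weight w p) _ _ ⟩
      weight w p + ((p x ∸ 2) * w x + suc (p y) * w y)  ∎)
      where
      open ≡-Reasoning
      exchange : ∀ {a} → 2 ≤ a → ∀ b {c d} → d ≡ c → c + ((a ∸ 2) * c + suc b * d) ≡ a * c + b * d
      exchange {suc (suc a)} (s≤s (s≤s _)) b {c} refl = shuffle a b c
        where
        shuffle : ∀ a b c → c + (a * c + suc b * c) ≡ suc (suc a) * c + b * c
        shuffle = solve-∀

  pebbles : Config → ℕ
  pebbles = weight (λ _ → 1)

  data Advance (Inv : Config → Set) (p : Config) : Set where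
    advance : ∀ {x y} → Adj x y → 2 ≤ p x → Inv (move p x y) → Advance Inv p

  module _ {root : V} where

    solvable-by-move-to-root : ∀ {p x} → Adj x root → 2 ≤ p x → Solvable root p
    solvable-by-move-to-root {p} {x} adj 2≤px =
      move p x root , move-Move adj 2≤px ◅ ε , subst (1 ≤_) (sym move-target) (s≤s z≤n)

    solvable-after-move : ∀ {p q} → Move p q → Solvable root q → Solvable root p
    solvable-after-move step (q′ , reach , pebbled) = q′ , step ◅ reach , pebbled

    advancing⇒solvable : (Inv : Config → Set) → (∀ p → Inv p → Solvable root p ⊎ Advance Inv p) →
                         ∀ p → Inv p → Solvable root p
    advancing⇒solvable Inv step p = go (suc (pebbles p)) p ≤-refl
      where
      go : ∀ fuel p → pebbles p < fuel → Inv p → Solvable root p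
      go (suc fuel) p p<fuel inv with step p inv
      ... | inj₁ solved = solved
      ... | inj₂ (advance {x} {y} adj 2≤px inv′) =
        solvable-after-move (move-Move adj 2≤px) (go fuel (move p x y) fewer inv′)
        where
        fewer : pebbles (move p x y) < fuel
        fewer = <-≤-trans (subst (pebbles (move p x y) <_) (weight-move-level _ p adj 2≤px refl)
                                 (m<m+n _ z<s))
                          (≤-pred p<fuel)

¬∃2≤⇒≤1 : ∀ {A : Set} {f : A → ℕ} → ¬ (Σ A λ a → 2 ≤ f a) → ∀ a → f a ≤ 1
¬∃2≤⇒≤1 none a = ≤-pred (≰⇒> (none ∘ (a ,_)))

≤1∧≢1⇒≡0 : ∀ {c} → c ≤ 1 → c ≢ 1 → c ≡ 0
≤1∧≢1⇒≡0 z≤n       _   = refl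
≤1∧≢1⇒≡0 (s≤s z≤n) c≢1 = ⊥-elim (c≢1 refl)

Ample : ℕ → ℕ → ℕ → ℕ → Set
Ample N w o z = N + o ≤ w × 2 * N + z ≤ 2 * w

module _ {N : ℕ} where

  Ample-initial : ∀ {w o z} → 2 * N ≤ w → o ≤ N → z ≤ w → Ample N w o z
  Ample-initial {w} {o} {z} 2N≤w o≤N z≤w =
    ≤-trans (+-monoʳ-≤ N o≤N) (subst (_≤ w) (cong (N +_) (+-identityʳ N)) 2N≤w) ,
    subst (2 * N + z ≤_) (cong (w +_) (sym (+-identityʳ w))) (+-mono-≤ 2N≤w z≤w)

  Ample-cong : ∀ {w w′ o o′ z z′} → w ≡ w′ → o ≡ o′ → z ≡ z′ → Ample N w o z → Ample N w′ o′ z′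
  Ample-cong refl refl refl ample = ample

  private
    drain-hub : ∀ {w z} → 2 * N + (z + 2) ≤ 2 * suc w → 2 * N + z ≤ 2 * w
    drain-hub {w} {z} le = +-cancelʳ-≤ 2 _ _
      (subst₂ _≤_ (sym (+-assoc (2 * N) z 2)) (trans (*-suc 2 w) (+-comm 2 (2 * w))) le)

  Ample-after-filling-odd : ∀ {w o z w′ o′ z′} → Ample N w o z →
                            suc w′ ≡ w → suc o′ ≡ o → z′ + 2 ≡ z → Ample N w′ o′ z′
  Ample-after-filling-odd {w′ = w′} {o′} (enough-odd , enough-hub) refl refl refl =
    ≤-pred (subst (_≤ suc w′) (+-suc N o′) enough-odd) , drain-hub enough-hub

  Ample-after-filling-empty : ∀ {w o z w′ o′ z′} → w + 2 ≤ N + o + z → Ample N w o z → o ≡ 0 →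
                              suc w′ ≡ w → o′ ≡ 1 → z′ + 2 ≡ z → Ample N w′ o′ z′
  Ample-after-filling-empty {w′ = w′} {z′ = z′} light (_ , enough-hub) refl refl refl refl =
    +-cancelʳ-≤ (w′ + N + z′) _ _ (begin
      N + 1 + (w′ + N + z′)        ≡⟨ shuffleˡ N w′ z′ ⟩
      w′ + 1 + (2 * N + z′)        ≤⟨ +-mono-≤ light′ (drain-hub enough-hub) ⟩
      N + z′ + 2 * w′              ≡⟨ shuffleʳ N w′ z′ ⟩
      w′ + (w′ + N + z′)           ∎) ,
    drain-hub enough-hub
    where
    open ≤-Reasoning
    light′ : w′ + 1 ≤ N + z′
    light′ = +-cancelʳ-≤ 2 _ _ (subst₂ _≤_ (shift-w w′) (shift-z N z′) light)
      where
      shift-w : ∀ w′ → suc w′ + 2 ≡ w′ + 1 + 2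
      shift-w = solve-∀
      shift-z : ∀ N z′ → N + 0 + (z′ + 2) ≡ N + z′ + 2
      shift-z = solve-∀
    shuffleˡ : ∀ N w′ z′ → N + 1 + (w′ + N + z′) ≡ w′ + 1 + (2 * N + z′)
    shuffleˡ = solve-∀
    shuffleʳ : ∀ N w′ z′ → N + z′ + 2 * w′ ≡ w′ + (w′ + N + z′)
    shuffleʳ = solve-∀

  ¬Ample-light : ∀ {w o z} → w + 2 ≤ N + o + z → z ≤ 1 → ¬ Ample N w o z
  ¬Ample-light {w} {o} {z} light z≤1 (enough-odd , _) = 2≰1 (+-cancelˡ-≤ (N + o) 2 1 (begin
    N + o + 2  ≤⟨ +-monoˡ-≤ 2 enough-odd ⟩
    w + 2      ≤⟨ light ⟩
    N + o + z  ≤⟨ +-monoʳ-≤ (N + o) z≤1 ⟩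
    N + o + 1  ∎))
    where
    open ≤-Reasoning
    2≰1 : ¬ 2 ≤ 1
    2≰1 (s≤s ())

module _ {n : ℕ} where

  _≟L_ : DecidableEquality (LV n)
  r   ≟L r    = yes refl
  v k ≟L v k′ = map′ (cong v) (λ { refl → refl }) (k Fin.≟ k′)
  u i ≟L u i′ = map′ (cong u) (λ { refl → refl }) (i Fin.≟ i′)
  r   ≟L v _  = no λ ()
  r   ≟L u _  = no λ ()
  v _ ≟L r    = no λ ()
  v _ ≟L u _  = no λ ()
  u _ ≟L r    = no λ ()
  u _ ≟L v _  = no λ ()

  ∈-Lverts : ∀ x → x ∈ Lverts n
  ∈-Lverts r     = here refl
  ∈-Lverts (v k) = there (∈-++⁺ˡ (∈-map⁺ v (∈-allFin k)))
  ∈-Lverts (u i) = there (∈-++⁺ʳ (map v (allFin n)) (∈-map⁺ u (∈-allFin i)))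

  Lverts-unique : Unique (Lverts n)
  Lverts-unique = r∉ ∷ Unique.++⁺ (Unique.map⁺ (λ { refl → refl }) (Unique.allFin⁺ n))
                                  (Unique.map⁺ (λ { refl → refl }) (Unique.allFin⁺ (NU n)))
                                  v-u-disjoint
    where
    r∉ : All (r ≢_) (map v (allFin n) ++ map u (allFin (NU n)))
    r∉ = All.++⁺ {xs = map v (allFin n)} (All.map⁺ {f = v} (All.universal (λ _ ()) _))
                                         (All.map⁺ {f = u} (All.universal (λ _ ()) _))
    v-u-disjoint : ∀ {x} → ¬ (x ∈ map v (allFin n) × x ∈ map u (allFin (NU n)))
    v-u-disjoint (x∈v , x∈u) with ∈-map⁻ v x∈v | ∈-map⁻ u x∈u
    ... | _ , _ , refl | _ , _ , ()

  LAdj-irrefl : ∀ {x} → ¬ LAdj n x x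
  LAdj-irrefl = [ LEdge-irrefl , LEdge-irrefl ]
    where
    LEdge-irrefl : ∀ {x} → ¬ LEdge n x x
    LEdge-irrefl (e-vv k .k k≡1+k) = 1+n≢n (sym k≡1+k)
    LEdge-irrefl (e-uu0 .zero 0≢0) = 0≢0 refl

  Lw≡0⇒r : ∀ x → Lw n x ≡ 0 → x ≡ r
  Lw≡0⇒r r     _      = refl
  Lw≡0⇒r (v k) 2^k+1≡0 = ⊥-elim (<⇒≢ (m^n>0 2 (suc (toℕ k))) (sym 2^k+1≡0))

  sum-map-Lverts : ∀ (f : LV n → ℕ) →
                   sum (map f (Lverts n)) ≡ f r + (sum (tabulate (f ∘ v)) + sum (tabulate (f ∘ u)))
  sum-map-Lverts f = cong (f r +_) (begin
    sum (map f (map v (allFin n) ++ map u (allFin (NU n))))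
      ≡⟨ cong (λ xs → sum (map f xs)) (cong₂ _++_ (map-tabulate id v) (map-tabulate id u)) ⟩
    sum (map f (tabulate v ++ tabulate u))
      ≡⟨ cong sum (map-++ f (tabulate v) (tabulate u)) ⟩
    sum (map f (tabulate v) ++ map f (tabulate u))
      ≡⟨ cong sum (cong₂ _++_ (map-tabulate v f) (map-tabulate u f)) ⟩
    sum (tabulate (f ∘ v) ++ tabulate (f ∘ u))
      ≡⟨ sum-++ (tabulate (f ∘ v)) _ ⟩
    sum (tabulate (f ∘ v)) + sum (tabulate (f ∘ u)) ∎)
    where open ≡-Reasoning

module _ (m : ℕ) where

  private
    n : ℕ
    n = suc m

  open PebblingMoves (LV n) (LAdj n) (Lverts n) _≟L_ Lverts-unique ∈-Lverts LAdj-irrefl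
  open LPeb n using (Config; Solvable; weight; one)

  N : ℕ
  N = 2 ^ suc n

  oddSpoke : LV n → ℕ → ℕ
  oddSpoke (u (suc _)) c = c % 2
  oddSpoke _           _ = 0

  oddSpokes : Config → ℕ
  oddSpokes = vertexSum oddSpoke

  pathWeight : Config → ℕ
  pathWeight p = sum (tabulate (λ k → p (v k) * 2 ^ suc (toℕ k)))

  spokePebbles : Config → ℕ
  spokePebbles p = sum (tabulate (λ i → p (u (suc i))))

  weight-split : ∀ p → weight (Lw n) p ≡ pathWeight p + spokePebbles p + p (u zero)
  weight-split p = begin
    weight (Lw n) p
      ≡⟨ sum-map-Lverts (λ x → p x * Lw n x) ⟩
    p r * 0 + (pathWeight p + (p (u zero) * 1 + sum (tabulate (λ i → p (u (suc i)) * 1))))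
      ≡⟨ cong₂ _+_ (*-zeroʳ (p r)) (cong (pathWeight p +_)
           (cong₂ _+_ (*-identityʳ _) (cong sum (tabulate-cong (λ i → *-identityʳ (p (u (suc i)))))))) ⟩
    pathWeight p + (p (u zero) + spokePebbles p)
      ≡⟨ x∙yz≈xz∙y (pathWeight p) _ _ ⟩
    pathWeight p + spokePebbles p + p (u zero) ∎
    where open ≡-Reasoning

  oddSpokes-split : ∀ p → oddSpokes p ≡ sum (tabulate (λ i → p (u (suc i)) % 2))
  oddSpokes-split p =
    trans (sum-map-Lverts (λ x → oddSpoke x (p x)))
          (cong (_+ sum (tabulate (λ i → p (u (suc i)) % 2))) (trans (sum-tabulate-const n 0) (*-zeroʳ n)))

  oddSpokes-≤ : ∀ p → oddSpokes p ≤ N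
  oddSpokes-≤ p = begin
    oddSpokes p                               ≡⟨ oddSpokes-split p ⟩
    sum (tabulate (λ i → p (u (suc i)) % 2))  ≤⟨ sum-tabulate-mono (λ i → ≤-pred (m%n<n (p (u (suc i))) 2)) ⟩
    sum (tabulate {n = N} (λ _ → 1))          ≡⟨ sum-tabulate-const N 1 ⟩
    N * 1                                     ≡⟨ *-identityʳ N ⟩
    N                                         ∎
    where open ≤-Reasoning

  oddSpokes-empty : ∀ p → (∀ i → p (u (suc i)) ≡ 0) → oddSpokes p ≡ 0
  oddSpokes-empty p empty = begin
    oddSpokes p                               ≡⟨ oddSpokes-split p ⟩
    sum (tabulate (λ i → p (u (suc i)) % 2))  ≡⟨ cong sum (tabulate-cong (λ i → cong (_% 2) (empty i))) ⟩
    sum (tabulate {n = N} (λ _ → 0))          ≡⟨ sum-tabulate-const N 0 ⟩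
    N * 0                                     ≡⟨ *-zeroʳ N ⟩
    0                                         ∎
    where open ≡-Reasoning

  hub≤weight : ∀ p → p (u zero) ≤ weight (Lw n) p
  hub≤weight p = subst (p (u zero) ≤_) (sym (weight-split p)) (m≤n+m _ _)

  pathWeight-one : pathWeight one + 2 ≡ N
  pathWeight-one = trans (cong (λ s → sum s + 2) (tabulate-cong {n = n} (λ k → *-identityˡ (2 ^ suc (toℕ k)))))
                         (sum-tabulate-2^ n)

  weight-one : suc (weight (Lw n) one) ≡ 2 * N
  weight-one = begin
    suc (weight (Lw n) one)                          ≡⟨ cong suc (weight-split one) ⟩
    suc (pathWeight one + spokePebbles one + 1)      ≡⟨ shuffle (pathWeight one) (spokePebbles one) ⟩
    pathWeight one + 2 + spokePebbles one            ≡⟨ cong₂ _+_ pathWeight-one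
                                                                  (trans (sum-tabulate-const N 1) (*-identityʳ N)) ⟩
    N + N                                            ≡⟨ cong (N +_) (+-identityʳ N) ⟨
    2 * N                                            ∎
    where
    open ≡-Reasoning
    shuffle : ∀ a b → suc (a + b + 1) ≡ a + 2 + b
    shuffle = solve-∀

  sparse⇒light : ∀ p → (∀ k → p (v k) ≤ 1) → (∀ i → p (u (suc i)) ≤ 1) →
                 weight (Lw n) p + 2 ≤ N + oddSpokes p + p (u zero)
  sparse⇒light p sparse-path sparse-spokes = begin
    weight (Lw n) p + 2                              ≡⟨ cong (_+ 2) (weight-split p) ⟩
    pathWeight p + spokePebbles p + p (u zero) + 2   ≡⟨ shuffle (pathWeight p) (spokePebbles p) (p (u zero)) ⟩
    pathWeight p + 2 + spokePebbles p + p (u zero)   ≤⟨ +-monoˡ-≤ (p (u zero)) (+-mono-≤ light-path light-spokes) ⟩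
    N + oddSpokes p + p (u zero)                     ∎
    where
    open ≤-Reasoning
    shuffle : ∀ a b c → a + b + c + 2 ≡ a + 2 + b + c
    shuffle = solve-∀
    ≤1⇒≤%2 : ∀ {c} → c ≤ 1 → c ≤ c % 2
    ≤1⇒≤%2 z≤n       = z≤n
    ≤1⇒≤%2 (s≤s z≤n) = s≤s z≤n
    light-path : pathWeight p + 2 ≤ N
    light-path = ≤-trans (+-monoˡ-≤ 2 (sum-tabulate-mono (λ k → *-monoˡ-≤ (2 ^ suc (toℕ k)) (sparse-path k))))
                         (≤-reflexive pathWeight-one)
    light-spokes : spokePebbles p ≤ oddSpokes p
    light-spokes = subst (spokePebbles p ≤_) (sym (oddSpokes-split p))
                         (sum-tabulate-mono (λ i → ≤1⇒≤%2 (sparse-spokes i)))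

  AmpleConfig : Config → Set
  AmpleConfig p = Ample N (weight (Lw n) p) (oddSpokes p) (p (u zero))

  oddSpoke-∸2 : ∀ x {c} → 2 ≤ c → oddSpoke x (c ∸ 2) ≡ oddSpoke x c
  oddSpoke-∸2 r        _ = refl
  oddSpoke-∸2 (v _)    _ = refl
  oddSpoke-∸2 (u zero) _ = refl
  oddSpoke-∸2 (u (suc _)) {suc (suc c)} (s≤s (s≤s _)) =
    sym (trans (cong (_% 2) (+-comm 2 c)) ([m+n]%n≡m%n c 2))

  oddSpokes-move-to-path : ∀ p {x} k → LAdj n x (v k) → 2 ≤ p x → oddSpokes (move p x (v k)) ≡ oddSpokes p
  oddSpokes-move-to-path p {x} k edge enough = +-cancelʳ-≡ (oddSpoke x (p x)) _ _ (begin
    oddSpokes (move p x (v k)) + oddSpoke x (p x)      ≡⟨ +-identityʳ _ ⟨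
    oddSpokes (move p x (v k)) + oddSpoke x (p x) + 0  ≡⟨ vertexSum-move oddSpoke p (Adj⇒≢ edge) ⟩
    oddSpokes p + oddSpoke x (p x ∸ 2) + 0             ≡⟨ +-identityʳ _ ⟩
    oddSpokes p + oddSpoke x (p x ∸ 2)                 ≡⟨ cong (oddSpokes p +_) (oddSpoke-∸2 x enough) ⟩
    oddSpokes p + oddSpoke x (p x)                     ∎)
    where open ≡-Reasoning

  toward-root : ∀ p {x} k → LAdj n x (v k) → Lw n (v k) ≡ 2 * Lw n x → x ≢ u zero → 2 ≤ p x →
                AmpleConfig p → Advance AmpleConfig p
  toward-root p {x} k edge doubling x≢hub enough =
    advance edge enough ∘ Ample-cong (sym (weight-move-doubling (Lw n) p edge enough doubling))
                                     (sym (oddSpokes-move-to-path p k edge enough))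
                                     (sym (move-elsewhere {p} {x} {v k} (x≢hub ∘ sym) λ ()))

  module _ (p : Config) (i : Fin N) (enough : 2 ≤ p (u zero)) where

    private
      q : Config
      q = move p (u zero) (u (suc i))

      edge : LAdj n (u zero) (u (suc i))
      edge = inj₂ (e-uu0 (suc i) λ ())

      weight-drop : suc (weight (Lw n) q) ≡ weight (Lw n) p
      weight-drop = trans (+-comm 1 _) (weight-move-level (Lw n) p edge enough refl)

      hub-drop : q (u zero) + 2 ≡ p (u zero)
      hub-drop = trans (cong (_+ 2) (move-source {p} {u zero} {u (suc i)} λ ())) (m∸n+n≡m enough)

      oddSpokes-change : oddSpokes q + p (u (suc i)) % 2 ≡ oddSpokes p + suc (p (u (suc i))) % 2
      oddSpokes-change = begin
        oddSpokes q + p (u (suc i)) % 2          ≡⟨ cong (_+ p (u (suc i)) % 2) (+-identityʳ _) ⟨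
        oddSpokes q + 0 + p (u (suc i)) % 2      ≡⟨ vertexSum-move oddSpoke p {u zero} {u (suc i)} (λ ()) ⟩
        oddSpokes p + 0 + suc (p (u (suc i))) % 2  ≡⟨ cong (_+ suc (p (u (suc i))) % 2) (+-identityʳ _) ⟩
        oddSpokes p + suc (p (u (suc i))) % 2      ∎
        where open ≡-Reasoning

    fill-odd-spoke : p (u (suc i)) ≡ 1 → AmpleConfig p → Advance AmpleConfig p
    fill-odd-spoke spoke≡1 ample =
      advance edge enough (Ample-after-filling-odd ample weight-drop odd-drop hub-drop)
      where
      odd-drop : suc (oddSpokes q) ≡ oddSpokes p
      odd-drop = trans (+-comm 1 _) (trans (subst (λ c → oddSpokes q + c % 2 ≡ oddSpokes p + suc c % 2)
                                                  spoke≡1 oddSpokes-change)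
                                           (+-identityʳ _))

    fill-empty-spoke : p (u (suc i)) ≡ 0 → oddSpokes p ≡ 0 →
                       weight (Lw n) p + 2 ≤ N + oddSpokes p + p (u zero) →
                       AmpleConfig p → Advance AmpleConfig p
    fill-empty-spoke spoke≡0 no-odd light ample =
      advance edge enough (Ample-after-filling-empty light ample no-odd weight-drop one-odd hub-drop)
      where
      one-odd : oddSpokes q ≡ 1
      one-odd = trans (sym (+-identityʳ _)) (trans (subst (λ c → oddSpokes q + c % 2 ≡ oddSpokes p + suc c % 2)
                                                          spoke≡0 oddSpokes-change)
                                                   (cong (_+ 1) no-odd))

  advance-or-solve : ∀ p → AmpleConfig p → Solvable r p ⊎ Advance AmpleConfig p
  advance-or-solve p ample with any? (λ k → 2 ≤? p (v k))
  ... | yes (k , enough) with suc (toℕ k) ≟ n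
  ...   | yes top = inj₁ (solvable-by-move-to-root (inj₂ (e-rv k top)) enough)
  ...   | no ¬top = inj₂ (toward-root p k′ (inj₂ (e-vv k k′ k′≡1+k)) (cong (λ j → 2 ^ suc j) k′≡1+k)
                                      (λ ()) enough ample)
    where
    k<n : suc (toℕ k) < n
    k<n = ≤∧≢⇒< (toℕ<n k) ¬top
    k′ : Fin n
    k′ = fromℕ< k<n
    k′≡1+k : toℕ k′ ≡ suc (toℕ k)
    k′≡1+k = toℕ-fromℕ< k<n
  advance-or-solve p ample | no sparse-path with any? (λ i → 2 ≤? p (u (suc i)))
  ... | yes (i , enough) =
    inj₂ (toward-root p zero (inj₂ (e-v1u zero refl (suc i) λ ())) refl (λ ()) enough ample)
  ... | no sparse-spokes with 2 ≤? p (u zero)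
  ...   | no sparse-hub = ⊥-elim (¬Ample-light {N} (sparse⇒light p (¬∃2≤⇒≤1 sparse-path) (¬∃2≤⇒≤1 sparse-spokes))
                                                   (≤-pred (≰⇒> sparse-hub)) ample)
  ...   | yes enough with any? (λ i → p (u (suc i)) ≟ 1)
  ...     | yes (i , spoke≡1) = inj₂ (fill-odd-spoke p i enough spoke≡1 ample)
  ...     | no no-odd-spoke =
    inj₂ (fill-empty-spoke p spoke₀ enough (empty spoke₀) (oddSpokes-empty p empty)
                           (sparse⇒light p (¬∃2≤⇒≤1 sparse-path) (¬∃2≤⇒≤1 sparse-spokes)) ample)
    where
    spoke₀ : Fin N
    spoke₀ = fromℕ< (m^n>0 2 (suc n))
    empty : ∀ i → p (u (suc i)) ≡ 0
    empty i = ≤1∧≢1⇒≡0 (¬∃2≤⇒≤1 sparse-spokes i) (no-odd-spoke ∘ (i ,_))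

  heavy⇒solvable : ∀ p → weight (Lw n) one < weight (Lw n) p → Solvable r p
  heavy⇒solvable p heavy = advancing⇒solvable AmpleConfig advance-or-solve p
    (Ample-initial {N} (subst (_≤ weight (Lw n) p) weight-one heavy) (oddSpokes-≤ p) (hub≤weight p))

theorem3 : ∀ n → 1 ≤ n → LPeb.Valid n r (Lw n)
theorem3 (suc m) _ = refl , Lw≡0⇒r , λ p unsolvable → ≮⇒≥ (unsolvable ∘ heavy⇒solvable m p)
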